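{- Let $q>p$ be positive coprime integers, and write the Euclidean division $q=ap+b$ with integers $a\ge 1$ and $1\le b\le p-1$. If $b=1$, then $$S(p,q)=\frac{1}{q^2}\sum_{n=0}^{p-1}\sum_{t=1}^{a}(an+t)(pt-n).$$ If $b\ge 2$, then $$S(p,q)=\frac{1}{q^2}\sum_{n=0}^{p-1}\sum_{t=1}^{a}(an+t)(tp-nb)+\frac{1}{q}\sum_{n=0}^{p-1}\sum_{t<\frac{nb}{p}}(an+t)+\frac{1}{q^2}\sum_{t=1}^{b-1}(ap+t)(q+pt-pb),$$ where in the middle double sum, for each $n$, $t$ runs over all positive integers with $t<\frac{nb}{p}$.
   Context: For a real number $x$, $\{x\}=x-\lfloor x\rfloor$ denotes the fractional part. For an integer $p$ and a positive integer $q$, $S(p,q)=\sum_{r=1}^{q-1}\left\{\frac{r}{q}\right\}\left\{\frac{rp}{q}\right\}$. -}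

module Defs where

open import Data.Nat as ℕ using (ℕ; zero; suc)
open import Data.Integer as ℤ using (ℤ; +_)
open import Data.Rational using (ℚ; _/_; 0ℚ; _+_; _*_; _-_; floor)
open import Data.Bool using (if_then_else_)

frac : ℚ → ℚ
frac x = x - (floor x / 1)

-- The rational number i / n; only ever used with n > 0
-- (value at n = 0 is an irrelevant junk value 0).
ratio : ℤ → ℕ → ℚ
ratio i zero    = 0ℚ
ratio i (suc n) = i / suc n

toℚ : ℤ → ℚ
toℚ i = i / 1

Σ< : ℕ → (ℕ → ℚ) → ℚ
Σ< zero    f = 0ℚ
Σ< (suc n) f = Σ< n f + f n

Σ1 : ℕ → (ℕ → ℚ) → ℚ
Σ1 n f = Σ< n (λ i → f (suc i))

S : ℤ → ℕ → ℚ
S p q = Σ1 (q ℕ.∸ 1) (λ r → frac (ratio (+ r) q) * frac (ratio (+ r ℤ.* p) q))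

-- For fixed n, b, p: Σ over positive integers t with t < nb/p (i.e. t·p < n·b)
-- of f t. Such t satisfy t ≤ n·b, so ranging over 1..n·b is exhaustive.
ΣBelow : (n b p : ℕ) → (ℕ → ℚ) → ℚ
ΣBelow n b p f = Σ1 (n ℕ.* b) (λ t → if (t ℕ.* p) ℕ.<ᵇ (n ℕ.* b) then f t else 0ℚ)

rhs₁ : (p q a : ℕ) → ℚ
rhs₁ p q a = ratio (+ 1) (q ℕ.* q) *
  Σ< p (λ n → Σ1 a (λ t → toℚ ((+ (a ℕ.* n ℕ.+ t)) ℤ.* ((+ (p ℕ.* t)) ℤ.- (+ n)))))

rhs₂ : (p q a b : ℕ) → ℚ
rhs₂ p q a b =
  ratio (+ 1) (q ℕ.* q) *
    Σ< p (λ n → Σ1 a (λ t → toℚ ((+ (a ℕ.* n ℕ.+ t)) ℤ.* ((+ (t ℕ.* p)) ℤ.- (+ (n ℕ.* b))))))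
  + ratio (+ 1) q *
    Σ< p (λ n → ΣBelow n b p (λ t → toℚ (+ (a ℕ.* n ℕ.+ t))))
  + ratio (+ 1) (q ℕ.* q) *
    Σ1 (b ℕ.∸ 1) (λ t → toℚ ((+ (a ℕ.* p ℕ.+ t)) ℤ.* ((+ (q ℕ.+ p ℕ.* t)) ℤ.- (+ (p ℕ.* b)))))

module Submission where

-- For 0 < r < q we have {r/q}{rp/q} = r (rp mod q) / q², and rp mod q = rp − q⌊rp/q⌋, so
-- q² S(p,q) = Σ r²p − q Σ r⌊rp/q⌋.  Cutting 0 < r < q = ap + b into the blocks r = an + t
-- (n < p, 1 ≤ t ≤ a) and the tail r = ap + t (t < b) produces the outer terms of the formula.
-- In the floor sum, ⌊rp/q⌋ counts the m ∈ [1, p) with mq ≤ rp; for fixed m these r are the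
-- r > am except the r = am + t with tp < mb, and those exceptions make up the middle sum.
-- With every subtracted term moved across, this is an identity in ℕ (key-identity), which is
-- then carried over to ℚ.

open import Data.Nat using (ℕ)

module NaturalSums where

  open import Data.Bool using (Bool; true; false; not; if_then_else_)
  open import Data.Nat
  open import Data.Nat.Properties
  open import Data.Nat.DivMod using (_/_; m/n*n≤m; m*n/n≡m; /-monoˡ-≤)
  open import Function.Base using (_∘_)
  open import Function.Bundles using (_⇔_; Equivalence)
  open import Relation.Binary.PropositionalEquality
  open import Relation.Nullary.Reflects using (ofʸ; ofⁿ; det; fromEquivalence)
  open import Algebra.Properties.CommutativeSemigroup +-commutativeSemigroup using (interchange)

  Σℕ< : ℕ → (ℕ → ℕ) → ℕ
  Σℕ< zero    f = 0
  Σℕ< (suc n) f = Σℕ< n f + f n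

  Σℕ1 : ℕ → (ℕ → ℕ) → ℕ
  Σℕ1 n f = Σℕ< n (λ i → f (suc i))

  when : Bool → ℕ → ℕ
  when c x = if c then x else 0

  when-zero : ∀ c → when c 0 ≡ 0
  when-zero true  = refl
  when-zero false = refl

  <ᵇ≡true : ∀ {m n} → m < n → (m <ᵇ n) ≡ true
  <ᵇ≡true {m} {n} m<n = det (<ᵇ-reflects-< m n) (ofʸ m<n)

  <ᵇ≡false : ∀ {m n} → n ≤ m → (m <ᵇ n) ≡ false
  <ᵇ≡false {m} {n} n≤m = det (<ᵇ-reflects-< m n) (ofⁿ (≤⇒≯ n≤m))

  <ᵇ-cong : ∀ {m n m′ n′} → m < n ⇔ m′ < n′ → (m <ᵇ n) ≡ (m′ <ᵇ n′)
  <ᵇ-cong {m} {n} {m′} {n′} m<n⇔m′<n′ =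
    det (<ᵇ-reflects-< m n) (fromEquivalence (from ∘ <ᵇ⇒< m′ n′) (<⇒<ᵇ ∘ to))
    where open Equivalence m<n⇔m′<n′

  Σℕ<-cong : ∀ n {f g : ℕ → ℕ} → (∀ i → i < n → f i ≡ g i) → Σℕ< n f ≡ Σℕ< n g
  Σℕ<-cong zero    f≡g = refl
  Σℕ<-cong (suc n) f≡g = cong₂ _+_ (Σℕ<-cong n (λ i i<n → f≡g i (m<n⇒m<1+n i<n))) (f≡g n (n<1+n n))

  Σℕ<-cong′ : ∀ n {f g : ℕ → ℕ} → (∀ i → f i ≡ g i) → Σℕ< n f ≡ Σℕ< n g
  Σℕ<-cong′ n f≡g = Σℕ<-cong n (λ i _ → f≡g i)

  Σℕ<-+ : ∀ n (f g : ℕ → ℕ) → Σℕ< n (λ i → f i + g i) ≡ Σℕ< n f + Σℕ< n g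
  Σℕ<-+ zero    f g = refl
  Σℕ<-+ (suc n) f g = trans (cong (_+ (f n + g n)) (Σℕ<-+ n f g)) (interchange (Σℕ< n f) (Σℕ< n g) (f n) (g n))

  Σℕ<-*ˡ : ∀ n c (f : ℕ → ℕ) → Σℕ< n (λ i → c * f i) ≡ c * Σℕ< n f
  Σℕ<-*ˡ zero    c f = sym (*-zeroʳ c)
  Σℕ<-*ˡ (suc n) c f = trans (cong (_+ c * f n) (Σℕ<-*ˡ n c f)) (sym (*-distribˡ-+ c (Σℕ< n f) (f n)))

  Σℕ<-const : ∀ n c → Σℕ< n (λ _ → c) ≡ n * c
  Σℕ<-const zero    c = refl
  Σℕ<-const (suc n) c = trans (cong (_+ c) (Σℕ<-const n c)) (+-comm (n * c) c)

  Σℕ<-zero : ∀ n (f : ℕ → ℕ) → (∀ i → i < n → f i ≡ 0) → Σℕ< n f ≡ 0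
  Σℕ<-zero n f f≡0 = trans (Σℕ<-cong n f≡0) (trans (Σℕ<-const n 0) (*-zeroʳ n))

  Σℕ<-split : ∀ m n (f : ℕ → ℕ) → Σℕ< (m + n) f ≡ Σℕ< m f + Σℕ< n (λ i → f (m + i))
  Σℕ<-split m zero    f = trans (cong (λ k → Σℕ< k f) (+-identityʳ m)) (sym (+-identityʳ _))
  Σℕ<-split m (suc n) f = begin
    Σℕ< (m + suc n) f                                  ≡⟨ cong (λ k → Σℕ< k f) (+-suc m n) ⟩
    Σℕ< (m + n) f + f (m + n)                          ≡⟨ cong (_+ f (m + n)) (Σℕ<-split m n f) ⟩
    (Σℕ< m f + Σℕ< n (λ i → f (m + i))) + f (m + n)    ≡⟨ +-assoc (Σℕ< m f) _ _ ⟩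
    Σℕ< m f + Σℕ< (suc n) (λ i → f (m + i))            ∎
    where open ≡-Reasoning

  Σℕ<-swap : ∀ m n (f : ℕ → ℕ → ℕ) →
             Σℕ< m (λ i → Σℕ< n (λ j → f i j)) ≡ Σℕ< n (λ j → Σℕ< m (λ i → f i j))
  Σℕ<-swap zero    n f = sym (Σℕ<-zero n (λ _ → 0) (λ _ _ → refl))
  Σℕ<-swap (suc m) n f = trans (cong (_+ Σℕ< n (f m)) (Σℕ<-swap m n f))
                               (sym (Σℕ<-+ n (λ j → Σℕ< m (λ i → f i j)) (f m)))

  Σℕ<-blocks : ∀ a p (f : ℕ → ℕ) → Σℕ< (a * p) f ≡ Σℕ< p (λ n → Σℕ< a (λ t → f (a * n + t)))
  Σℕ<-blocks a zero    f = cong (λ k → Σℕ< k f) (*-zeroʳ a)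
  Σℕ<-blocks a (suc p) f = begin
    Σℕ< (a * suc p) f                              ≡⟨ cong (λ k → Σℕ< k f) (trans (*-suc a p) (+-comm a (a * p))) ⟩
    Σℕ< (a * p + a) f                              ≡⟨ Σℕ<-split (a * p) a f ⟩
    Σℕ< (a * p) f + Σℕ< a (λ t → f (a * p + t))    ≡⟨ cong (_+ Σℕ< a (λ t → f (a * p + t))) (Σℕ<-blocks a p f) ⟩
    Σℕ< (suc p) (λ n → Σℕ< a (λ t → f (a * n + t))) ∎
    where open ≡-Reasoning

  Σℕ<-truncate : ∀ k n (f : ℕ → ℕ) → k ≤ n → (∀ i → k ≤ i → i < n → f i ≡ 0) → Σℕ< n f ≡ Σℕ< k f
  Σℕ<-truncate k n f k≤n f≡0 = begin
    Σℕ< n f                                          ≡⟨ cong (λ l → Σℕ< l f) (sym (m+[n∸m]≡n k≤n)) ⟩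
    Σℕ< (k + (n ∸ k)) f                              ≡⟨ Σℕ<-split k (n ∸ k) f ⟩
    Σℕ< k f + Σℕ< (n ∸ k) (λ i → f (k + i))          ≡⟨ cong (Σℕ< k f +_) (Σℕ<-zero (n ∸ k) _ tail≡0) ⟩
    Σℕ< k f + 0                                      ≡⟨ +-identityʳ _ ⟩
    Σℕ< k f                                          ∎
    where
      open ≡-Reasoning
      tail≡0 : ∀ i → i < n ∸ k → f (k + i) ≡ 0
      tail≡0 i i<n∸k = f≡0 (k + i) (m≤m+n k i) (subst (k + i <_) (m+[n∸m]≡n k≤n) (+-monoʳ-< k i<n∸k))

  Σℕ1-blocks : ∀ a p c (f : ℕ → ℕ) →
               Σℕ1 (a * p + c) f ≡ Σℕ< p (λ n → Σℕ1 a (λ t → f (a * n + t))) + Σℕ1 c (λ j → f (a * p + j))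
  Σℕ1-blocks a p c f = begin
    Σℕ1 (a * p + c) f
      ≡⟨ Σℕ<-split (a * p) c _ ⟩
    Σℕ< (a * p) (λ i → f (suc i)) + Σℕ< c (λ j → f (suc (a * p + j)))
      ≡⟨ cong₂ _+_ (Σℕ<-blocks a p _) (Σℕ<-cong′ c (λ j → cong f (sym (+-suc (a * p) j)))) ⟩
    Σℕ< p (λ n → Σℕ< a (λ t → f (suc (a * n + t)))) + Σℕ1 c (λ j → f (a * p + j))
      ≡⟨ cong (_+ Σℕ1 c (λ j → f (a * p + j))) (Σℕ<-cong′ p (λ n → Σℕ<-cong′ a (λ t → cong f (sym (+-suc (a * n) t))))) ⟩
    Σℕ< p (λ n → Σℕ1 a (λ t → f (a * n + t))) + Σℕ1 c (λ j → f (a * p + j))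
      ∎
    where open ≡-Reasoning

  Σℕ<-count : ∀ l n x (c : ℕ → Bool) → l ≤ n →
              (∀ k → k < l → c k ≡ true) → (∀ k → l ≤ k → k < n → c k ≡ false) →
              Σℕ< n (λ k → when (c k) x) ≡ l * x
  Σℕ<-count l n x c l≤n true-below false-above = begin
    Σℕ< n (λ k → when (c k) x)   ≡⟨ Σℕ<-truncate l n _ l≤n (λ k l≤k k<n → cong (λ β → when β x) (false-above k l≤k k<n)) ⟩
    Σℕ< l (λ k → when (c k) x)   ≡⟨ Σℕ<-cong l (λ k k<l → cong (λ β → when β x) (true-below k k<l)) ⟩
    Σℕ< l (λ _ → x)              ≡⟨ Σℕ<-const l x ⟩
    l * x                        ∎
    where open ≡-Reasoning

  Σℕ<-<ᵇ-count : ∀ n k x → n ≤ k → Σℕ< k (λ i → when (i <ᵇ n) x) ≡ n * x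
  Σℕ<-<ᵇ-count n k x n≤k = Σℕ<-count n k x _ n≤k (λ i i<n → <ᵇ≡true i<n) (λ i n≤i _ → <ᵇ≡false n≤i)

  Σℕ<-/-count : ∀ m n k x .{{_ : NonZero n}} → m / n ≤ k →
                Σℕ< k (λ i → when (not (m <ᵇ suc i * n)) x) ≡ m / n * x
  Σℕ<-/-count m n k x m/n≤k = Σℕ<-count (m / n) k x _ m/n≤k multiple-below multiple-above
    where
      multiple-below : ∀ i → i < m / n → not (m <ᵇ suc i * n) ≡ true
      multiple-below i i<m/n = cong not (<ᵇ≡false (≤-trans (*-monoˡ-≤ n i<m/n) (m/n*n≤m m n)))
      multiple-above : ∀ i → m / n ≤ i → i < k → not (m <ᵇ suc i * n) ≡ false
      multiple-above i m/n≤i _ = cong not (<ᵇ≡true (≰⇒> λ [1+i]n≤m →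
        <⇒≱ (s≤s m/n≤i) (subst (_≤ m / n) (m*n/n≡m (suc i) n) (/-monoˡ-≤ n [1+i]n≤m))))


module KeyIdentity (a p′ b′ : ℕ) where

  open import Data.Bool using (true; false; not)
  open import Data.Nat
  open import Data.Nat.Properties
  open import Data.Nat.DivMod using (_/_; _%_; m≡m%n+[m/n]*n; m<n*o⇒m/o<n)
  open import Function.Bundles using (mk⇔)
  open import Relation.Binary.PropositionalEquality
  open import Relation.Nullary.Reflects using (ofⁿ)
  open import Data.Nat.Tactic.RingSolver using (solve-∀)
  open NaturalSums

  p b q : ℕ
  p = suc p′
  b = suc b′
  q = suc (a * p + b′)

  q≡ap+b : q ≡ a * p + b
  q≡ap+b = sym (+-suc (a * p) b′)

  m*q≡a*m*p+m*b : ∀ m → m * q ≡ a * m * p + m * b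
  m*q≡a*m*p+m*b m = trans (cong (m *_) q≡ap+b) (distrib m a p b)
    where
      distrib : ∀ m a p b → m * (a * p + b) ≡ a * m * p + m * b
      distrib = solve-∀

  module Multiples (k : ℕ) where

    m : ℕ
    m = suc k

    above : ℕ → ℕ
    above r = when (a * m <ᵇ r) r

    reached : ℕ → ℕ
    reached r = when (not (r * p <ᵇ m * q)) r

    unreached : ℕ → ℕ
    unreached r = when (r * p <ᵇ m * q) (above r)

    shortfall : ℕ → ℕ
    shortfall j = when (j * p <ᵇ m * b) (a * m + j)

    above≡reached+unreached : ∀ r → above r ≡ reached r + unreached r
    above≡reached+unreached r with r * p <ᵇ m * q | <ᵇ-reflects-< (r * p) (m * q)
    ... | true  | _            = refl
    ... | false | ofⁿ rp≮mq    = trans (cong (λ β → when β r) (<ᵇ≡true am<r)) (sym (+-identityʳ r))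
      where
        am<r : a * m < r
        am<r = ≰⇒> λ r≤am → rp≮mq (begin-strict
          r * p              ≤⟨ *-monoˡ-≤ p r≤am ⟩
          a * m * p          <⟨ m<m+n (a * m * p) z<s ⟩
          a * m * p + m * b  ≡⟨ sym (m*q≡a*m*p+m*b m) ⟩
          m * q              ∎)
          where open ≤-Reasoning

    module _ (m≤p : m ≤ p) where

      Σabove : Σℕ1 (a * p + b′) above ≡
               Σℕ< p (λ n → Σℕ1 a (λ t → when (k <ᵇ n) (a * n + t))) + Σℕ1 b′ (λ j → a * p + j)
      Σabove = trans (Σℕ1-blocks a p b′ above) (cong₂ _+_
        (Σℕ<-cong′ p λ n → Σℕ<-cong a λ t t<a → cong (λ β → when β (a * n + suc t)) (block-above n t<a))
        (Σℕ<-cong′ b′ λ j → cong (λ β → when β (a * p + suc j)) (<ᵇ≡true (tail-above j))))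
        where
          block-above : ∀ n {t} → t < a → (a * m <ᵇ a * n + suc t) ≡ (k <ᵇ n)
          block-above n {t} t<a = <ᵇ-cong (mk⇔ to from)
            where
              to : a * m < a * n + suc t → k < n
              to am<an+t = ≰⇒> λ n≤k → <⇒≱ am<an+t (begin
                a * n + suc t  ≤⟨ +-monoʳ-≤ (a * n) t<a ⟩
                a * n + a      ≡⟨ trans (*-suc a n) (+-comm a (a * n)) ⟨
                a * suc n      ≤⟨ *-monoʳ-≤ a (s≤s n≤k) ⟩
                a * m          ∎)
                where open ≤-Reasoning
              from : k < n → a * m < a * n + suc t
              from k<n = ≤-<-trans (*-monoʳ-≤ a k<n) (m<m+n (a * n) z<s)
          tail-above : ∀ j → a * m < a * p + suc j
          tail-above j = ≤-<-trans (*-monoʳ-≤ a m≤p) (m<m+n (a * p) z<s)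

      shortfall-vanishes : ∀ j → b′ ≤ j → shortfall (suc j) ≡ 0
      shortfall-vanishes j b′≤j = cong (λ β → when β (a * m + suc j)) (<ᵇ≡false (begin
        m * b          ≤⟨ *-mono-≤ m≤p (s≤s b′≤j) ⟩
        p * suc j      ≡⟨ *-comm p (suc j) ⟩
        suc j * p      ∎))
        where open ≤-Reasoning

      Σshortfall-truncate : ∀ n → b′ ≤ n → Σℕ1 n shortfall ≡ Σℕ1 b′ shortfall
      Σshortfall-truncate n b′≤n = Σℕ<-truncate b′ n _ b′≤n (λ j b′≤j _ → shortfall-vanishes j b′≤j)

      unreached-shift : ∀ j → unreached (a * m + suc j) ≡ shortfall (suc j)
      unreached-shift j = trans
        (cong (λ β → when ((a * m + suc j) * p <ᵇ m * q) (when β (a * m + suc j))) (<ᵇ≡true (m<m+n (a * m) z<s)))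
        (cong (λ β → when β (a * m + suc j)) (<ᵇ-cong (mk⇔ to from)))
        where
          distrib : (a * m + suc j) * p ≡ a * m * p + suc j * p
          distrib = *-distribʳ-+ p (a * m) (suc j)
          to : (a * m + suc j) * p < m * q → suc j * p < m * b
          to lt = +-cancelˡ-< (a * m * p) _ _ (subst₂ _<_ distrib (m*q≡a*m*p+m*b m) lt)
          from : suc j * p < m * b → (a * m + suc j) * p < m * q
          from lt = subst₂ _<_ (sym distrib) (sym (m*q≡a*m*p+m*b m)) (+-monoʳ-< (a * m * p) lt)

      Σunreached : Σℕ1 (a * p + b′) unreached ≡ Σℕ1 (m * b) shortfall
      Σunreached = begin
        Σℕ1 (a * p + b′) unreached
          ≡⟨ cong (λ n → Σℕ1 n unreached) (sym (m+[n∸m]≡n am≤ap+b′)) ⟩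
        Σℕ1 (a * m + v) unreached
          ≡⟨ Σℕ<-split (a * m) v _ ⟩
        Σℕ1 (a * m) unreached + Σℕ< v (λ j → unreached (suc (a * m + j)))
          ≡⟨ cong₂ _+_ (Σℕ<-zero (a * m) _ below-vanishes)
                       (Σℕ<-cong′ v λ j → trans (cong unreached (sym (+-suc (a * m) j))) (unreached-shift j)) ⟩
        Σℕ1 v shortfall
          ≡⟨ Σshortfall-truncate v b′≤v ⟩
        Σℕ1 b′ shortfall
          ≡⟨ Σshortfall-truncate (m * b) b′≤mb ⟨
        Σℕ1 (m * b) shortfall
          ∎
        where
          open ≡-Reasoning
          v : ℕ
          v = a * p + b′ ∸ a * m
          am≤ap+b′ : a * m ≤ a * p + b′
          am≤ap+b′ = ≤-trans (*-monoʳ-≤ a m≤p) (m≤m+n (a * p) b′)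
          b′≤v : b′ ≤ v
          b′≤v = m+n≤o⇒m≤o∸n b′ (subst (_≤ a * p + b′) (+-comm (a * m) b′) (+-monoˡ-≤ b′ (*-monoʳ-≤ a m≤p)))
          b′≤mb : b′ ≤ m * b
          b′≤mb = ≤-trans (n≤1+n b′) (m≤n*m b m)
          below-vanishes : ∀ i → i < a * m → unreached (suc i) ≡ 0
          below-vanishes i i<am = trans
            (cong (λ β → when (suc i * p <ᵇ m * q) (when β (suc i))) (<ᵇ≡false i<am))
            (when-zero (suc i * p <ᵇ m * q))

      Σreached+Σshortfall : Σℕ1 (a * p + b′) reached + Σℕ1 (m * b) shortfall ≡
                            Σℕ< p (λ n → Σℕ1 a (λ t → when (k <ᵇ n) (a * n + t))) + Σℕ1 b′ (λ j → a * p + j)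
      Σreached+Σshortfall = begin
        Σℕ1 (a * p + b′) reached + Σℕ1 (m * b) shortfall
          ≡⟨ cong (Σℕ1 (a * p + b′) reached +_) Σunreached ⟨
        Σℕ1 (a * p + b′) reached + Σℕ1 (a * p + b′) unreached
          ≡⟨ Σℕ<-+ (a * p + b′) _ _ ⟨
        Σℕ1 (a * p + b′) (λ r → reached r + unreached r)
          ≡⟨ Σℕ<-cong′ (a * p + b′) (λ i → above≡reached+unreached (suc i)) ⟨
        Σℕ1 (a * p + b′) above
          ≡⟨ Σabove ⟩
        Σℕ< p (λ n → Σℕ1 a (λ t → when (k <ᵇ n) (a * n + t))) + Σℕ1 b′ (λ j → a * p + j)
          ∎
        where open ≡-Reasoning

  twistedSum floorSum squareSum shortfallSum : ℕ
  twistedSum   = Σℕ1 (a * p + b′) (λ r → r * (r * p % q))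
  floorSum     = Σℕ1 (a * p + b′) (λ r → r * p / q * r)
  squareSum    = Σℕ1 (a * p + b′) (λ r → r * r * p)
  shortfallSum = Σℕ< p (λ n → Σℕ1 (n * b) (λ j → when (j * p <ᵇ n * b) (a * n + j)))

  blockSquares blockWeights tailSquares tailWeights : ℕ
  blockSquares = Σℕ< p (λ n → Σℕ1 a (λ t → (a * n + t) * (a * n + t) * p))
  blockWeights = Σℕ< p (λ n → Σℕ1 a (λ t → n * (a * n + t)))
  tailSquares  = Σℕ1 b′ (λ j → (a * p + j) * (a * p + j) * p)
  tailWeights  = Σℕ1 b′ (λ j → p′ * (a * p + j))

  twistedSum+q*floorSum : twistedSum + q * floorSum ≡ squareSum
  twistedSum+q*floorSum = begin
    twistedSum + q * floorSum
      ≡⟨ cong (twistedSum +_) (Σℕ<-*ˡ (a * p + b′) q _) ⟨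
    twistedSum + Σℕ1 (a * p + b′) (λ r → q * (r * p / q * r))
      ≡⟨ Σℕ<-+ (a * p + b′) _ _ ⟨
    Σℕ1 (a * p + b′) (λ r → r * (r * p % q) + q * (r * p / q * r))
      ≡⟨ Σℕ<-cong′ (a * p + b′) (λ i → weighted-division (suc i) (suc i * p)) ⟩
    Σℕ1 (a * p + b′) (λ r → r * (r * p))
      ≡⟨ Σℕ<-cong′ (a * p + b′) (λ i → *-assoc (suc i) (suc i) p) ⟨
    squareSum
      ∎
    where
      open ≡-Reasoning
      weighted-division : ∀ r n → r * (n % q) + q * (n / q * r) ≡ r * n
      weighted-division r n = trans (regroup r (n % q) (n / q) q) (cong (r *_) (sym (m≡m%n+[m/n]*n n q)))
        where
          regroup : ∀ r x y q → r * x + q * (y * r) ≡ r * (x + y * q)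
          regroup = solve-∀

  squareSum≡blockSquares+tailSquares : squareSum ≡ blockSquares + tailSquares
  squareSum≡blockSquares+tailSquares = Σℕ1-blocks a p b′ (λ r → r * r * p)

  open Multiples using (reached; shortfall; Σreached+Σshortfall)

  floorSum≡Σreached : floorSum ≡ Σℕ< p′ (λ k → Σℕ1 (a * p + b′) (reached k))
  floorSum≡Σreached = trans
    (Σℕ<-cong (a * p + b′) (λ i i<q-1 → sym (Σℕ<-/-count (suc i * p) q p′ (suc i) (quotient-bound (s≤s i<q-1)))))
    (Σℕ<-swap (a * p + b′) p′ _)
    where
      quotient-bound : ∀ {r} → r < q → r * p / q ≤ p′
      quotient-bound {r} r<q = ≤-pred (m<n*o⇒m/o<n (subst (r * p <_) (*-comm q p) (*-monoˡ-< p r<q)))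

  floorSum+shortfallSum : floorSum + shortfallSum ≡ blockWeights + tailWeights
  floorSum+shortfallSum = begin
    floorSum + shortfallSum
      ≡⟨ cong₂ _+_ floorSum≡Σreached (Σℕ<-split 1 p′ _) ⟩
    -- the n = 0 summand of shortfallSum is an empty sum
    Σℕ< p′ (λ k → Σℕ1 (a * p + b′) (reached k)) + Σℕ< p′ (λ k → Σℕ1 (suc k * b) (shortfall k))
      ≡⟨ Σℕ<-+ p′ _ _ ⟨
    Σℕ< p′ (λ k → Σℕ1 (a * p + b′) (reached k) + Σℕ1 (suc k * b) (shortfall k))
      ≡⟨ Σℕ<-cong p′ (λ k k<p′ → Σreached+Σshortfall k (m≤n⇒m≤1+n k<p′)) ⟩
    Σℕ< p′ (λ k → Σℕ< p (λ n → Σℕ1 a (λ t → when (k <ᵇ n) (a * n + t))) + Σℕ1 b′ (λ j → a * p + j))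
      ≡⟨ Σℕ<-+ p′ _ _ ⟩
    Σℕ< p′ (λ k → Σℕ< p (λ n → Σℕ1 a (λ t → when (k <ᵇ n) (a * n + t)))) + Σℕ< p′ (λ k → Σℕ1 b′ (λ j → a * p + j))
      ≡⟨ cong₂ _+_ (trans (Σℕ<-swap p′ p _) (Σℕ<-cong′ p (λ n → Σℕ<-swap p′ a _))) (Σℕ<-swap p′ b′ _) ⟩
    Σℕ< p (λ n → Σℕ1 a (λ t → Σℕ< p′ (λ k → when (k <ᵇ n) (a * n + t)))) + Σℕ1 b′ (λ j → Σℕ< p′ (λ _ → a * p + j))
      ≡⟨ cong₂ _+_ (Σℕ<-cong p (λ n n<p → Σℕ<-cong′ a (λ t → Σℕ<-<ᵇ-count n p′ _ (≤-pred n<p))))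
                   (Σℕ<-cong′ b′ (λ j → Σℕ<-const p′ (a * p + suc j))) ⟩
    blockWeights + tailWeights
      ∎
    where open ≡-Reasoning

  key-identity : twistedSum + q * blockWeights + q * tailWeights ≡ blockSquares + q * shortfallSum + tailSquares
  key-identity = begin
    twistedSum + q * blockWeights + q * tailWeights
      ≡⟨ regroup twistedSum q blockWeights tailWeights ⟩
    twistedSum + q * (blockWeights + tailWeights)
      ≡⟨ cong (λ x → twistedSum + q * x) floorSum+shortfallSum ⟨
    twistedSum + q * (floorSum + shortfallSum)
      ≡⟨ regroup′ twistedSum q floorSum shortfallSum ⟩
    (twistedSum + q * floorSum) + q * shortfallSum
      ≡⟨ cong (_+ q * shortfallSum) (trans twistedSum+q*floorSum squareSum≡blockSquares+tailSquares) ⟩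
    blockSquares + tailSquares + q * shortfallSum
      ≡⟨ +-comm-last blockSquares tailSquares (q * shortfallSum) ⟩
    blockSquares + q * shortfallSum + tailSquares
      ∎
    where
      open ≡-Reasoning
      regroup : ∀ t q x y → t + q * x + q * y ≡ t + q * (x + y)
      regroup = solve-∀
      regroup′ : ∀ t q x y → t + q * (x + y) ≡ (t + q * x) + q * y
      regroup′ = solve-∀
      +-comm-last : ∀ x y z → x + y + z ≡ x + z + y
      +-comm-last = solve-∀

module Rationals where

  open import Data.Nat as ℕ using (ℕ; zero; suc)
  import Data.Nat.Properties as ℕP
  import Data.Nat.DivMod as ℕD
  open import Data.Nat.Coprimality using (Coprime)
  open import Data.Nat.GCD using (gcd; gcd[m,n]∣m; gcd[m,n]∣n; gcd[m,n]≢0; n/gcd[m,n]≢0)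
  open import Data.Integer as ℤ using (ℤ; +_)
  import Data.Integer.Properties as ℤP
  open import Data.Rational
  open import Data.Rational.Properties
  open import Data.Rational.Unnormalised using (mkℚᵘ; *≡*) renaming (_≃_ to _≃ᵘ_)
  import Data.Rational.Unnormalised.Properties as ℚᵘP
  open import Data.Sum using (inj₂)
  open import Data.Bool using (if_then_else_)
  open import Relation.Binary.PropositionalEquality
  open import Data.Integer.Tactic.RingSolver using (solve-∀)
  open import Data.Rational.Solver using (module +-*-Solver)
  open +-*-Solver using (solve; _:+_; _:*_; _:-_; con; _:=_)
  open import Defs
  open NaturalSums using (Σℕ<)

  ι : ℕ → ℚ
  ι n = toℚ (+ n)

  1/suc : ℕ → ℚ
  1/suc k = + 1 / suc k

  toℚᵘ-/ : ∀ i k → toℚᵘ (i / suc k) ≃ᵘ mkℚᵘ i k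
  toℚᵘ-/ i k = toℚᵘ-fromℚᵘ (mkℚᵘ i k)

  toℚ-+ : ∀ i j → toℚ (i ℤ.+ j) ≡ toℚ i + toℚ j
  toℚ-+ i j = toℚᵘ-injective (ℚᵘP.≃-trans (toℚᵘ-/ (i ℤ.+ j) 0) (ℚᵘP.≃-sym (ℚᵘP.≃-trans
    (toℚᵘ-homo-+ (toℚ i) (toℚ j)) (ℚᵘP.≃-trans (ℚᵘP.+-cong (toℚᵘ-/ i 0) (toℚᵘ-/ j 0)) (*≡* (over-1 i j))))))
    where
      over-1 : ∀ i j → (i ℤ.* + 1 ℤ.+ j ℤ.* + 1) ℤ.* + 1 ≡ (i ℤ.+ j) ℤ.* + 1
      over-1 = solve-∀

  toℚ-neg : ∀ i → toℚ (ℤ.- i) ≡ - toℚ i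
  toℚ-neg i = toℚᵘ-injective (ℚᵘP.≃-trans (toℚᵘ-/ (ℤ.- i) 0)
    (ℚᵘP.≃-sym (ℚᵘP.≃-trans (toℚᵘ-homo‿- (toℚ i)) (ℚᵘP.-‿cong (toℚᵘ-/ i 0)))))

  toℚ-* : ∀ i j → toℚ (i ℤ.* j) ≡ toℚ i * toℚ j
  toℚ-* i j = toℚᵘ-injective (ℚᵘP.≃-trans (toℚᵘ-/ (i ℤ.* j) 0)
    (ℚᵘP.≃-sym (ℚᵘP.≃-trans (toℚᵘ-homo-* (toℚ i) (toℚ j)) (ℚᵘP.*-cong (toℚᵘ-/ i 0) (toℚᵘ-/ j 0)))))

  ι-+ : ∀ m n → ι (m ℕ.+ n) ≡ ι m + ι n
  ι-+ m n = trans (cong toℚ (ℤP.pos-+ m n)) (toℚ-+ (+ m) (+ n))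

  ι-* : ∀ m n → ι (m ℕ.* n) ≡ ι m * ι n
  ι-* m n = trans (cong toℚ (ℤP.pos-* m n)) (toℚ-* (+ m) (+ n))

  /-suc≡*1/suc : ∀ i k → i / suc k ≡ toℚ i * 1/suc k
  /-suc≡*1/suc i k = toℚᵘ-injective (ℚᵘP.≃-trans (toℚᵘ-/ i k) (ℚᵘP.≃-trans (*≡* eq) (ℚᵘP.≃-sym (ℚᵘP.≃-trans
    (toℚᵘ-homo-* (toℚ i) (1/suc k)) (ℚᵘP.*-cong (toℚᵘ-/ i 0) (toℚᵘ-/ (+ 1) k))))))
    where
      eq : i ℤ.* + suc (k ℕ.+ 0) ≡ (i ℤ.* + 1) ℤ.* + suc k
      eq = trans (cong (λ n → i ℤ.* + suc n) (ℕP.+-identityʳ k)) (cong (ℤ._* + suc k) (sym (ℤP.*-identityʳ i)))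

  1/suc-square : ∀ k → ratio (+ 1) (suc k ℕ.* suc k) ≡ 1/suc k * 1/suc k
  1/suc-square k = toℚᵘ-injective (ℚᵘP.≃-trans (toℚᵘ-/ (+ 1) (k ℕ.+ k ℕ.* suc k)) (ℚᵘP.≃-sym (ℚᵘP.≃-trans
    (toℚᵘ-homo-* (1/suc k) (1/suc k)) (ℚᵘP.≃-trans (ℚᵘP.*-cong (toℚᵘ-/ (+ 1) k) (toℚᵘ-/ (+ 1) k)) (*≡* refl)))))

  1/suc-inverse : ∀ k → 1/suc k * ι (suc k) ≡ 1ℚ
  1/suc-inverse k = toℚᵘ-injective (ℚᵘP.≃-trans (toℚᵘ-homo-* (1/suc k) (ι (suc k)))
    (ℚᵘP.≃-trans (ℚᵘP.*-cong (toℚᵘ-/ (+ 1) k) (toℚᵘ-/ (+ suc k) 0)) (*≡* eq)))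
    where
      eq : (+ 1 ℤ.* + suc k) ℤ.* + 1 ≡ + 1 ℤ.* + suc (k ℕ.* 1)
      eq = trans (unit (+ suc k)) (cong (λ n → + 1 ℤ.* + suc n) (sym (ℕP.*-identityʳ k)))
        where
          unit : ∀ n → (+ 1 ℤ.* n) ℤ.* + 1 ≡ + 1 ℤ.* n
          unit = solve-∀

  floor-/ : ∀ m k → floor (+ m / suc k) ≡ + (m ℕ./ suc k)
  -- + m / suc k normalises to mkℚ+ (m / g) (suc k / g) with g = gcd m (suc k).
  floor-/ m k = trans (floor-mkℚ+ (m ℕ./ g) (suc k ℕ./ g) _) (cong +_ cancel-gcd)
    where
      floor-mkℚ+ : ∀ n d .{{_ : ℕ.NonZero d}} .(c : Coprime n d) → floor (mkℚ+ n d c) ≡ + (n ℕ./ d)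
      floor-mkℚ+ n (suc d) c = ℤP.*-identityˡ _
      g : ℕ
      g = gcd m (suc k)
      instance
        g≢0 : ℕ.NonZero g
        g≢0 = ℕ.≢-nonZero (gcd[m,n]≢0 m (suc k) (inj₂ (λ ())))
        d/g≢0 : ℕ.NonZero (suc k ℕ./ g)
        d/g≢0 = ℕ.≢-nonZero (n/gcd[m,n]≢0 m (suc k))
        d/g*g≢0 : ℕ.NonZero ((suc k ℕ./ g) ℕ.* g)
        d/g*g≢0 = subst ℕ.NonZero (sym (ℕD.m/n*n≡m (gcd[m,n]∣n m (suc k)))) _
      cancel-gcd : (m ℕ./ g) ℕ./ (suc k ℕ./ g) ≡ m ℕ./ suc k
      cancel-gcd = trans (sym (ℕD.m*n/o*n≡m/o (m ℕ./ g) g (suc k ℕ./ g)))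
        (trans (ℕD./-congˡ (ℕD.m/n*n≡m (gcd[m,n]∣m m (suc k)))) (ℕD./-congʳ (ℕD.m/n*n≡m (gcd[m,n]∣n m (suc k)))))

  frac-/ : ∀ m k → frac (+ m / suc k) ≡ + (m ℕ.% suc k) / suc k
  frac-/ m k = begin
    + m / d - toℚ (floor (+ m / d))   ≡⟨ cong (λ z → + m / d - toℚ z) (floor-/ m k) ⟩
    + m / d - ι s                     ≡⟨ cong (_- ι s) (/-suc≡*1/suc (+ m) k) ⟩
    ι m * c - ι s                     ≡⟨ cong (λ n → ι n * c - ι s) (ℕD.m≡m%n+[m/n]*n m d) ⟩
    ι (r ℕ.+ s ℕ.* d) * c - ι s       ≡⟨ cong (λ x → x * c - ι s) (trans (ι-+ r (s ℕ.* d)) (cong (λ y → ι r + y) (ι-* s d))) ⟩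
    (ι r + ι s * ι d) * c - ι s       ≡⟨ expand (ι r) (ι s) (ι d) c ⟩
    ι r * c + ι s * (c * ι d) - ι s   ≡⟨ cong (λ x → ι r * c + ι s * x - ι s) (1/suc-inverse k) ⟩
    ι r * c + ι s * 1ℚ - ι s          ≡⟨ cancel (ι r) (ι s) c ⟩
    ι r * c                           ≡⟨ /-suc≡*1/suc (+ r) k ⟨
    + r / d                           ∎
    where
      open ≡-Reasoning
      d r s : ℕ
      d = suc k
      r = m ℕ.% d
      s = m ℕ./ d
      c : ℚ
      c = 1/suc k
      expand : ∀ x y z w → (x + y * z) * w - y ≡ x * w + y * (w * z) - y
      expand = solve 4 (λ x y z w → (x :+ y :* z) :* w :- y := x :* w :+ y :* (w :* z) :- y) refl
      cancel : ∀ x y w → x * w + y * 1ℚ - y ≡ x * w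
      cancel = solve 3 (λ x y w → x :* w :+ y :* con 1ℚ :- y := x :* w) refl

  ι-difference : ∀ x u v c d → x ℕ.* u ℕ.+ d ≡ c ℕ.+ x ℕ.* v → toℚ (+ x ℤ.* (+ u ℤ.- + v)) ≡ ι c - ι d
  ι-difference x u v c d xu+d≡c+xv = begin
    toℚ (+ x ℤ.* (+ u ℤ.- + v))    ≡⟨ toℚ-* (+ x) (+ u ℤ.- + v) ⟩
    ι x * toℚ (+ u ℤ.+ ℤ.- + v)    ≡⟨ cong (ι x *_) (trans (toℚ-+ (+ u) (ℤ.- + v)) (cong (λ y → ι u + y) (toℚ-neg (+ v)))) ⟩
    ι x * (ι u - ι v)              ≡⟨ rearrange (ι x) (ι u) (ι v) (ι d) ⟩
    (ι x * ι u + ι d) - ι d - ι x * ι v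
      ≡⟨ cong (λ y → y - ι d - ι x * ι v) (trans (sym xu+d) (trans (cong ι xu+d≡c+xv) c+xv)) ⟩
    (ι c + ι x * ι v) - ι d - ι x * ι v
      ≡⟨ cancel (ι c) (ι x * ι v) (ι d) ⟩
    ι c - ι d                      ∎
    where
      open ≡-Reasoning
      xu+d : ι (x ℕ.* u ℕ.+ d) ≡ ι x * ι u + ι d
      xu+d = trans (ι-+ (x ℕ.* u) d) (cong (_+ ι d) (ι-* x u))
      c+xv : ι (c ℕ.+ x ℕ.* v) ≡ ι c + ι x * ι v
      c+xv = trans (ι-+ c (x ℕ.* v)) (cong (λ y → ι c + y) (ι-* x v))
      rearrange : ∀ x u v d → x * (u - v) ≡ (x * u + d) - d - x * v
      rearrange = solve 4 (λ x u v d → x :* (u :- v) := (x :* u :+ d) :- d :- x :* v) refl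
      cancel : ∀ c y d → (c + y) - d - y ≡ c - d
      cancel = solve 3 (λ c y d → (c :+ y) :- d :- y := c :- d) refl

  Σ<-cong : ∀ n {f g : ℕ → ℚ} → (∀ i → i ℕ.< n → f i ≡ g i) → Σ< n f ≡ Σ< n g
  Σ<-cong zero    f≡g = refl
  Σ<-cong (suc n) f≡g = cong₂ _+_ (Σ<-cong n (λ i i<n → f≡g i (ℕP.m<n⇒m<1+n i<n))) (f≡g n (ℕP.n<1+n n))

  Σ<-cong′ : ∀ n {f g : ℕ → ℚ} → (∀ i → f i ≡ g i) → Σ< n f ≡ Σ< n g
  Σ<-cong′ n f≡g = Σ<-cong n (λ i _ → f≡g i)

  Σ<-*ˡ : ∀ n c (f : ℕ → ℚ) → Σ< n (λ i → c * f i) ≡ c * Σ< n f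
  Σ<-*ˡ zero    c f = sym (*-zeroʳ c)
  Σ<-*ˡ (suc n) c f = trans (cong (_+ c * f n) (Σ<-*ˡ n c f)) (sym (*-distribˡ-+ c (Σ< n f) (f n)))

  Σ<-sub : ∀ n (f g : ℕ → ℚ) → Σ< n (λ i → f i - g i) ≡ Σ< n f - Σ< n g
  Σ<-sub zero    f g = refl
  Σ<-sub (suc n) f g = trans (cong (_+ (f n - g n)) (Σ<-sub n f g)) (interchange (Σ< n f) (Σ< n g) (f n) (g n))
    where
      interchange : ∀ w x y z → w - x + (y - z) ≡ w + y - (x + z)
      interchange = solve 4 (λ w x y z → w :- x :+ (y :- z) := w :+ y :- (x :+ z)) refl

  Σ<-zero : ∀ n (f : ℕ → ℚ) → (∀ i → i ℕ.< n → f i ≡ 0ℚ) → Σ< n f ≡ 0ℚ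
  Σ<-zero zero    f f≡0 = refl
  Σ<-zero (suc n) f f≡0 =
    trans (cong₂ _+_ (Σ<-zero n f (λ i i<n → f≡0 i (ℕP.m<n⇒m<1+n i<n))) (f≡0 n (ℕP.n<1+n n))) (+-identityʳ 0ℚ)

  Σ<-ι : ∀ n (f : ℕ → ℕ) → Σ< n (λ i → ι (f i)) ≡ ι (Σℕ< n f)
  Σ<-ι zero    f = refl
  Σ<-ι (suc n) f = trans (cong (_+ ι (f n)) (Σ<-ι n f)) (sym (ι-+ (Σℕ< n f) (f n)))

  Σ<-ι-difference : ∀ n (f : ℕ → ℚ) (g h : ℕ → ℕ) → (∀ i → i ℕ.< n → f i ≡ ι (g i) - ι (h i)) →
                    Σ< n f ≡ ι (Σℕ< n g) - ι (Σℕ< n h)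
  Σ<-ι-difference n f g h f≡ = trans (Σ<-cong n f≡) (trans (Σ<-sub n _ _) (cong₂ _-_ (Σ<-ι n g) (Σ<-ι n h)))

  rhs₂[b=1]≡rhs₁ : ∀ p q a → rhs₂ p q a 1 ≡ rhs₁ p q a
  rhs₂[b=1]≡rhs₁ p q a = begin
    K * X₁′ + ratio (+ 1) q * X₂ + K * 0ℚ   ≡⟨ cong₂ (λ x y → K * x + ratio (+ 1) q * y + K * 0ℚ) X₁′≡X₁ X₂≡0 ⟩
    K * X₁ + ratio (+ 1) q * 0ℚ + K * 0ℚ    ≡⟨ drop-zeros K X₁ (ratio (+ 1) q) ⟩
    K * X₁                                  ∎
    where
      open ≡-Reasoning
      K X₁ X₁′ X₂ : ℚ
      K = ratio (+ 1) (q ℕ.* q)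
      X₁ = Σ< p (λ n → Σ1 a (λ t → toℚ (+ (a ℕ.* n ℕ.+ t) ℤ.* (+ (p ℕ.* t) ℤ.- + n))))
      X₁′ = Σ< p (λ n → Σ1 a (λ t → toℚ (+ (a ℕ.* n ℕ.+ t) ℤ.* (+ (t ℕ.* p) ℤ.- + (n ℕ.* 1)))))
      X₂ = Σ< p (λ n → ΣBelow n 1 p (λ t → toℚ (+ (a ℕ.* n ℕ.+ t))))
      X₁′≡X₁ : X₁′ ≡ X₁
      X₁′≡X₁ = Σ<-cong′ p λ n → Σ<-cong′ a λ t →
        cong₂ (λ u v → toℚ (+ (a ℕ.* n ℕ.+ suc t) ℤ.* (+ u ℤ.- + v))) (ℕP.*-comm (suc t) p) (ℕP.*-identityʳ n)
      X₂≡0 : X₂ ≡ 0ℚ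
      X₂≡0 = Σ<-zero p _ λ n n<p → Σ<-zero (n ℕ.* 1) _ λ j _ →
        cong (λ β → if β then toℚ (+ (a ℕ.* n ℕ.+ suc j)) else 0ℚ)
             (NaturalSums.<ᵇ≡false (ℕP.≤-trans (ℕP.≤-reflexive (ℕP.*-identityʳ n))
                                    (ℕP.≤-trans (ℕP.<⇒≤ n<p) (ℕP.m≤m+n p (j ℕ.* p)))))
      drop-zeros : ∀ k x r → k * x + r * 0ℚ + k * 0ℚ ≡ k * x
      drop-zeros = solve 3 (λ k x r → k :* x :+ r :* con 0ℚ :+ k :* con 0ℚ := k :* x) refl

module Translation (a p′ b′ : ℕ) where

  open import Data.Bool using (true; false; if_then_else_)
  open import Data.Nat as ℕ using (ℕ; suc; _<ᵇ_)
  import Data.Nat.DivMod as ℕD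
  open import Data.Integer as ℤ using (+_)
  import Data.Integer.Properties as ℤP
  open import Data.Rational using (ℚ; _+_; _*_; _-_; 0ℚ; 1ℚ; _/_)
  open import Relation.Binary.PropositionalEquality
  open import Data.Nat.Tactic.RingSolver using (solve-∀)
  open import Data.Rational.Solver using (module +-*-Solver)
  open +-*-Solver using (solve; _:+_; _:*_; _:-_; con; _:=_)
  open import Defs
  open NaturalSums using (Σℕ<; Σℕ1; when; Σℕ<-*ˡ; Σℕ<-cong′)
  open KeyIdentity a p′ b′
  open Rationals

  N : ℕ
  N = a ℕ.* p ℕ.+ b′

  K c : ℚ
  K = ratio (+ 1) (q ℕ.* q)
  c = 1/suc N

  K≡c*c : K ≡ c * c
  K≡c*c = 1/suc-square N

  S≡K*twistedSum : S (+ p) q ≡ K * ι twistedSum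
  S≡K*twistedSum = trans (Σ<-cong N term) (trans (Σ<-*ˡ N K _) (cong (K *_) (Σ<-ι N _)))
    where
      term : ∀ i → i ℕ.< N →
             frac (ratio (+ suc i) q) * frac (ratio (+ suc i ℤ.* + p) q) ≡ K * ι (suc i ℕ.* (suc i ℕ.* p ℕ.% q))
      term i i<N = begin
        frac (+ r / q) * frac (ratio (+ r ℤ.* + p) q)  ≡⟨ cong (λ z → frac (+ r / q) * frac (ratio z q)) (ℤP.pos-* r p) ⟨
        frac (+ r / q) * frac (+ (r ℕ.* p) / q)        ≡⟨ cong₂ _*_ (frac-/ r N) (frac-/ (r ℕ.* p) N) ⟩
        + (r ℕ.% q) / q * (+ u / q)                    ≡⟨ cong (λ z → + z / q * (+ u / q)) (ℕD.m<n⇒m%n≡m (ℕ.s≤s i<N)) ⟩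
        + r / q * (+ u / q)                            ≡⟨ cong₂ _*_ (/-suc≡*1/suc (+ r) N) (/-suc≡*1/suc (+ u) N) ⟩
        ι r * c * (ι u * c)                            ≡⟨ regroup (ι r) (ι u) c ⟩
        c * c * (ι r * ι u)                            ≡⟨ cong₂ _*_ K≡c*c (ι-* r u) ⟨
        K * ι (r ℕ.* u)                                ∎
        where
          open ≡-Reasoning
          r u : ℕ
          r = suc i
          u = r ℕ.* p ℕ.% q
          regroup : ∀ x y z → x * z * (y * z) ≡ z * z * (x * y)
          regroup = solve 3 (λ x y z → x :* z :* (y :* z) := z :* z :* (x :* y)) refl

  blockPart shortfallPart tailPart : ℚ
  blockPart     = Σ< p (λ n → Σ1 a (λ t → toℚ (+ (a ℕ.* n ℕ.+ t) ℤ.* (+ (t ℕ.* p) ℤ.- + (n ℕ.* b)))))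
  shortfallPart = Σ< p (λ n → ΣBelow n b p (λ t → toℚ (+ (a ℕ.* n ℕ.+ t))))
  tailPart      = Σ1 (b ℕ.∸ 1) (λ t → toℚ (+ (a ℕ.* p ℕ.+ t) ℤ.* (+ (q ℕ.+ p ℕ.* t) ℤ.- + (p ℕ.* b))))

  blockPart≡squares-weights : blockPart ≡ ι blockSquares - ι (q ℕ.* blockWeights)
  blockPart≡squares-weights = trans
    (Σ<-ι-difference p _ (λ n → Σℕ1 a (λ t → square n t)) (λ n → Σℕ1 a (λ t → q ℕ.* weight n t)) λ n _ →
      Σ<-ι-difference a _ (λ t → square n (suc t)) (λ t → q ℕ.* weight n (suc t)) λ t _ →
        ι-difference (a ℕ.* n ℕ.+ suc t) _ _ _ _ (per-term n (suc t)))
    (cong (λ x → ι blockSquares - ι x) (trans (Σℕ<-cong′ p (λ n → Σℕ<-*ˡ a q _)) (Σℕ<-*ˡ p q _)))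
    where
      square weight : ℕ → ℕ → ℕ
      square n t = (a ℕ.* n ℕ.+ t) ℕ.* (a ℕ.* n ℕ.+ t) ℕ.* p
      weight n t = n ℕ.* (a ℕ.* n ℕ.+ t)
      per-term : ∀ n t → (a ℕ.* n ℕ.+ t) ℕ.* (t ℕ.* p) ℕ.+ q ℕ.* weight n t ≡ square n t ℕ.+ (a ℕ.* n ℕ.+ t) ℕ.* (n ℕ.* b)
      per-term n t = trans (cong (λ z → (a ℕ.* n ℕ.+ t) ℕ.* (t ℕ.* p) ℕ.+ z ℕ.* weight n t) q≡ap+b) (expand a n t p b)
        where
          expand : ∀ a n t p b → (a ℕ.* n ℕ.+ t) ℕ.* (t ℕ.* p) ℕ.+ (a ℕ.* p ℕ.+ b) ℕ.* (n ℕ.* (a ℕ.* n ℕ.+ t)) ≡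
                                 (a ℕ.* n ℕ.+ t) ℕ.* (a ℕ.* n ℕ.+ t) ℕ.* p ℕ.+ (a ℕ.* n ℕ.+ t) ℕ.* (n ℕ.* b)
          expand = solve-∀

  tailPart≡squares-weights : tailPart ≡ ι tailSquares - ι (q ℕ.* tailWeights)
  tailPart≡squares-weights = trans
    (Σ<-ι-difference b′ _ (λ j → square (suc j)) (λ j → q ℕ.* weight (suc j)) λ j _ →
      ι-difference (a ℕ.* p ℕ.+ suc j) _ _ _ _ (per-term (suc j)))
    (cong (λ x → ι tailSquares - ι x) (Σℕ<-*ˡ b′ q _))
    where
      square weight : ℕ → ℕ
      square t = (a ℕ.* p ℕ.+ t) ℕ.* (a ℕ.* p ℕ.+ t) ℕ.* p
      weight t = p′ ℕ.* (a ℕ.* p ℕ.+ t)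
      per-term : ∀ t → (a ℕ.* p ℕ.+ t) ℕ.* (q ℕ.+ p ℕ.* t) ℕ.+ q ℕ.* weight t ≡ square t ℕ.+ (a ℕ.* p ℕ.+ t) ℕ.* (p ℕ.* b)
      per-term t = trans (cong (λ z → (a ℕ.* p ℕ.+ t) ℕ.* (z ℕ.+ p ℕ.* t) ℕ.+ z ℕ.* weight t) q≡ap+b) (expand a p′ b t)
        where
          expand : ∀ a p′ b t → (a ℕ.* suc p′ ℕ.+ t) ℕ.* ((a ℕ.* suc p′ ℕ.+ b) ℕ.+ suc p′ ℕ.* t) ℕ.+
                                (a ℕ.* suc p′ ℕ.+ b) ℕ.* (p′ ℕ.* (a ℕ.* suc p′ ℕ.+ t)) ≡
                                (a ℕ.* suc p′ ℕ.+ t) ℕ.* (a ℕ.* suc p′ ℕ.+ t) ℕ.* suc p′ ℕ.+ (a ℕ.* suc p′ ℕ.+ t) ℕ.* (suc p′ ℕ.* b)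
          expand = solve-∀

  shortfallPart≡shortfallSum : shortfallPart ≡ ι shortfallSum
  shortfallPart≡shortfallSum = trans (Σ<-cong′ p λ n → trans (Σ<-cong′ (n ℕ.* b) λ j → if-ι (suc j ℕ.* p <ᵇ n ℕ.* b) _) (Σ<-ι (n ℕ.* b) _))
                        (Σ<-ι p _)
    where
      if-ι : ∀ β x → (if β then ι x else 0ℚ) ≡ ι (when β x)
      if-ι true  x = refl
      if-ι false x = refl

  1/q*ι≡K*ι[q*] : ∀ x → ratio (+ 1) q * ι x ≡ K * ι (q ℕ.* x)
  1/q*ι≡K*ι[q*] x = sym (begin
    K * ι (q ℕ.* x)          ≡⟨ cong₂ _*_ K≡c*c (ι-* q x) ⟩
    c * c * (ι q * ι x)      ≡⟨ regroup c (ι q) (ι x) ⟩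
    c * (c * ι q) * ι x      ≡⟨ cong (λ y → c * y * ι x) (1/suc-inverse N) ⟩
    c * 1ℚ * ι x             ≡⟨ unit c (ι x) ⟩
    c * ι x                  ∎)
    where
      open ≡-Reasoning
      regroup : ∀ x y z → x * x * (y * z) ≡ x * (x * y) * z
      regroup = solve 3 (λ x y z → x :* x :* (y :* z) := x :* (x :* y) :* z) refl
      unit : ∀ x y → x * 1ℚ * y ≡ x * y
      unit = solve 2 (λ x y → x :* con 1ℚ :* y := x :* y) refl

  key-identityℚ : ι twistedSum + ι (q ℕ.* blockWeights) + ι (q ℕ.* tailWeights) ≡
                  ι blockSquares + ι (q ℕ.* shortfallSum) + ι tailSquares
  key-identityℚ = trans (sym (ι-+₃ twistedSum (q ℕ.* blockWeights) (q ℕ.* tailWeights)))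
    (trans (cong ι key-identity) (ι-+₃ blockSquares (q ℕ.* shortfallSum) tailSquares))
    where
      ι-+₃ : ∀ x y z → ι (x ℕ.+ y ℕ.+ z) ≡ ι x + ι y + ι z
      ι-+₃ x y z = trans (ι-+ (x ℕ.+ y) z) (cong (_+ ι z) (ι-+ x y))

  S≡rhs₂ : S (+ p) q ≡ rhs₂ p q a b
  S≡rhs₂ = begin
    S (+ p) q
      ≡⟨ S≡K*twistedSum ⟩
    K * ι twistedSum
      ≡⟨ isolate K (ι twistedSum) (ι (q ℕ.* blockWeights)) (ι (q ℕ.* tailWeights))
                   (ι blockSquares) (ι (q ℕ.* shortfallSum)) (ι tailSquares) key-identityℚ ⟩
    K * (ι blockSquares - ι (q ℕ.* blockWeights)) + K * ι (q ℕ.* shortfallSum) + K * (ι tailSquares - ι (q ℕ.* tailWeights))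
      ≡⟨ cong₂ (λ x y → K * x + y + K * (ι tailSquares - ι (q ℕ.* tailWeights))) blockPart≡squares-weights
               (trans (cong (ratio (+ 1) q *_) shortfallPart≡shortfallSum) (1/q*ι≡K*ι[q*] shortfallSum)) ⟨
    K * blockPart + ratio (+ 1) q * shortfallPart + K * (ι tailSquares - ι (q ℕ.* tailWeights))
      ≡⟨ cong (λ x → K * blockPart + ratio (+ 1) q * shortfallPart + K * x) tailPart≡squares-weights ⟨
    rhs₂ p q a b
      ∎
    where
      open ≡-Reasoning
      isolate : ∀ k t x y z u v → t + x + y ≡ z + u + v → k * t ≡ k * (z - x) + k * u + k * (v - y)
      isolate k t x y z u v t+x+y≡z+u+v = begin
        k * t                                ≡⟨ add-subtract k t x y ⟩
        k * ((t + x + y) - x - y)            ≡⟨ cong (λ w → k * (w - x - y)) t+x+y≡z+u+v ⟩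
        k * ((z + u + v) - x - y)            ≡⟨ distribute k x y z u v ⟩
        k * (z - x) + k * u + k * (v - y)    ∎
        where
          add-subtract : ∀ k t x y → k * t ≡ k * ((t + x + y) - x - y)
          add-subtract = solve 4 (λ k t x y → k :* t := k :* ((t :+ x :+ y) :- x :- y)) refl
          distribute : ∀ k x y z u v → k * ((z + u + v) - x - y) ≡ k * (z - x) + k * u + k * (v - y)
          distribute = solve 6 (λ k x y z u v → k :* ((z :+ u :+ v) :- x :- y) := k :* (z :- x) :+ k :* u :+ k :* (v :- y)) refl

open import Data.Nat using (zero; suc; _+_; _*_; _≤_; _<_)
open import Data.Nat.Properties using (+-suc)
open import Data.Nat.Coprimality using (Coprime)
open import Data.Integer using (+_)
open import Data.Product using (_×_; _,_)
open import Relation.Binary.PropositionalEquality using (_≡_; sym; trans; subst)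
open import Defs
open Rationals using (rhs₂[b=1]≡rhs₁)

proposition1 : (p q a b : ℕ) → 1 ≤ p → p < q → Coprime p q →
    q ≡ a * p + b → 1 ≤ a → 1 ≤ b → b < p →
    (b ≡ 1 → S (+ p) q ≡ rhs₁ p q a) × (2 ≤ b → S (+ p) q ≡ rhs₂ p q a b)
proposition1 zero _ _ _ ()
proposition1 (suc _) _ _ zero _ _ _ _ _ ()
proposition1 (suc p′) q a (suc b′) _ _ _ q≡ap+b _ _ _ = S≡rhs₁ , λ _ → S≡rhs₂
  where
    S≡rhs₂ : S (+ suc p′) q ≡ rhs₂ (suc p′) q a (suc b′)
    S≡rhs₂ = subst (λ r → S (+ suc p′) r ≡ rhs₂ (suc p′) r a (suc b′))
                   (sym (trans q≡ap+b (+-suc (a * suc p′) b′)))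
                   (Translation.S≡rhs₂ a p′ b′)
    S≡rhs₁ : suc b′ ≡ 1 → S (+ suc p′) q ≡ rhs₁ (suc p′) q a
    S≡rhs₁ b≡1 = trans S≡rhs₂ (subst (λ β → rhs₂ (suc p′) q a β ≡ rhs₁ (suc p′) q a) (sym b≡1) (rhs₂[b=1]≡rhs₁ (suc p′) q a))
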